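{- (Substitution rule.) Let $A(\vec x,y)$ be a formula of $\mathcal{L}_1$ with free variables among $\vec x,y$ and $r$ an interactive realizer such that $r\Vdash\vec\alpha,\beta:A(\vec x,y)$ for all individuals $\vec\alpha,\beta$ in $\mathcal{S}\mathbb{N}$. Then for every term $t\in\mathcal{L}_1$ with free variables among $\vec x$, and all individuals $\vec\alpha,\beta$, $r\Vdash\vec\alpha,\beta:A(\vec x,t)$, where $A(\vec x,t)$ is the result of substituting $t$ for $y$.
   Context: $\mathcal{L}_1$: quantifier-free language of primitive recursive arithmetic (variables, $0$, $\mathsf{succ}$, symbols for primitive recursive functions and predicates, $=$, $\neg,\wedge,\vee,\rightarrow$) extended with a $k$-ary function symbol $\varphi_P$ and $k$-ary predicate symbol $\chi_P$ for each $(k+1)$-ary predicate symbol $P$. A state is a finite set $s$ of triples $\langle P,\vec m,n\rangle$ with $P(\vec m,n)$ true in the standard model and at most one $n$ per $(P,\vec m)$; $\mathbb{S}$ is the set of states, ordered by inclusion $\sqsubseteq$; compatible states have a state as union. $\mathcal{S}X=\mathbb{S}\to X$. Under an environment $\xi:\mathrm{Var}\to\mathcal{S}\mathbb{N}$: $[\![x]\!]_\xi=\xi(x)$, $[\![0]\!]_\xi=\lambda s.0$, $\mathcal{L}_0$-symbols pointwise with standard meaning, $[\![\varphi_P(\vec t)]\!]_\xi(s)=n$ if $\langle P,[\![\vec t]\!]_\xi(s),n\rangle\in s$ and $0$ otherwise, $[\![\chi_P(\vec t)]\!]_\xi(s)=\mathsf{true}$ iff such $n$ exists, connectives pointwise boolean.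 An individual is $\alpha\in\mathcal{S}X$ such that $\alpha(\sigma(i))$ is eventually constant for every $\sigma:\mathbb{N}\to\mathbb{S}$ with $\sigma(i)\sqsubseteq\sigma(j)$ for $i\le j$. An interactive realizer is an individual $r\in\mathcal{S}\mathbb{S}$ with $r(s)$ compatible with $s$ and $r(s)\cap s=\emptyset$; $\mathrm{Prefix}(r)=\{s\mid r(s)\sqsubseteq s\}$. For $A$ with free variables among $z_1,\ldots,z_k$ and $\vec\gamma\in(\mathcal{S}\mathbb{N})^k$, $r\Vdash\vec\gamma:A$ means $[\![A]\!]_{[\lambda\_.\gamma_i(s)/z_i]}(s)=\mathsf{true}$ for every $s\in\mathrm{Prefix}(r)$. -}

module Defs where

open import Data.Nat using (ℕ; zero; suc; _≤_)
import Data.Nat as ℕ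
open import Data.Fin using (Fin)
import Data.Fin as F
open import Data.Vec using (Vec; []; _∷_; _∷ʳ_)
import Data.Vec.Properties as VP
open import Data.Vec.Functional using (Vector)
open import Data.List using (List; _++_)
open import Data.List.Membership.Propositional using (_∈_)
open import Data.Product using (Σ; ∃; _×_; _,_)
open import Data.Bool using (Bool; true; false; not; _∧_; _∨_)
open import Data.Maybe using (Maybe; just; nothing)
open import Relation.Nullary using (¬_; Dec; yes; no)
open import Relation.Nullary.Decidable using (⌊_⌋)
open import Relation.Binary.PropositionalEquality using (_≡_; refl; cong; cong₂)

data PR : ℕ → Set where
  zeroF : ∀ {n} → PR n
  succF : PR 1
  proj  : ∀ {n} → Fin n → PR n
  comp  : ∀ {m n} → PR m → Vec (PR n) m → PR n
  rec   : ∀ {n} → PR n → PR (suc (suc n)) → PR (suc n)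

mutual
  evalPR : ∀ {n} → PR n → Vec ℕ n → ℕ
  evalPR zeroF v = 0
  evalPR succF (x ∷ []) = suc x
  evalPR (proj i) v = Data.Vec.lookup v i
  evalPR (comp f gs) v = evalPR f (evalPRs gs v)
  evalPR (rec f g) (zero ∷ v) = evalPR f v
  evalPR (rec f g) (suc x ∷ v) = evalPR g (evalPR (rec f g) (x ∷ v) ∷ x ∷ v)

  evalPRs : ∀ {m n} → Vec (PR n) m → Vec ℕ n → Vec ℕ m
  evalPRs [] v = []
  evalPRs (g ∷ gs) v = evalPR g v ∷ evalPRs gs v

-- A primitive recursive predicate is given by (a code of) its
-- characteristic function: P(v) holds iff the function value is nonzero.
Holds : ∀ {n} → PR n → Vec ℕ n → Set
Holds P v = ¬ (evalPR P v ≡ 0)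

holds? : ∀ {n} → PR n → Vec ℕ n → Bool
holds? P v = not ⌊ evalPR P v ℕ.≟ 0 ⌋

private
  comp-inj : ∀ {m m' n} {f : PR m} {f' : PR m'} {gs : Vec (PR n) m} {gs'} →
             comp f gs ≡ comp f' gs' → m ≡ m'
  comp-inj refl = refl
  comp-inj₂ : ∀ {m n} {f f' : PR m} {gs gs' : Vec (PR n) m} →
              comp f gs ≡ comp f' gs' → (f ≡ f') × (gs ≡ gs')
  comp-inj₂ refl = refl , refl
  rec-inj : ∀ {n} {f f' : PR n} {g g'} → rec f g ≡ rec f' g' → (f ≡ f') × (g ≡ g')
  rec-inj refl = refl , refl
  proj-inj : ∀ {n} {i j : Fin n} → proj i ≡ proj j → i ≡ j
  proj-inj refl = refl

mutual
  _≟PR_ : ∀ {n} (f g : PR n) → Dec (f ≡ g)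
  zeroF ≟PR zeroF = yes refl
  zeroF ≟PR succF = no λ ()
  zeroF ≟PR proj _ = no λ ()
  zeroF ≟PR comp _ _ = no λ ()
  zeroF ≟PR rec _ _ = no λ ()
  succF ≟PR zeroF = no λ ()
  succF ≟PR succF = yes refl
  succF ≟PR proj _ = no λ ()
  succF ≟PR comp _ _ = no λ ()
  succF ≟PR rec _ _ = no λ ()
  proj _ ≟PR zeroF = no λ ()
  proj _ ≟PR succF = no λ ()
  proj i ≟PR proj j with i F.≟ j
  ... | yes refl = yes refl
  ... | no ne = no λ e → ne (proj-inj e)
  proj _ ≟PR comp _ _ = no λ ()
  proj _ ≟PR rec _ _ = no λ ()
  comp _ _ ≟PR zeroF = no λ ()
  comp _ _ ≟PR succF = no λ ()
  comp _ _ ≟PR proj _ = no λ ()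
  comp {m} f gs ≟PR comp {m'} f' gs' with m ℕ.≟ m'
  ... | no ne = no λ e → ne (comp-inj e)
  ... | yes refl with f ≟PR f' | gs ≟PRs gs'
  ... | yes refl | yes refl = yes refl
  ... | no ne | _ = no λ e → ne (Data.Product.proj₁ (comp-inj₂ e))
  ... | yes _ | no ne = no λ e → ne (Data.Product.proj₂ (comp-inj₂ e))
  comp _ _ ≟PR rec _ _ = no λ ()
  rec _ _ ≟PR zeroF = no λ ()
  rec _ _ ≟PR succF = no λ ()
  rec _ _ ≟PR proj _ = no λ ()
  rec _ _ ≟PR comp _ _ = no λ ()
  rec f g ≟PR rec f' g' with f ≟PR f' | g ≟PR g'
  ... | yes refl | yes refl = yes refl
  ... | no ne | _ = no λ e → ne (Data.Product.proj₁ (rec-inj e))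
  ... | yes _ | no ne = no λ e → ne (Data.Product.proj₂ (rec-inj e))

  _≟PRs_ : ∀ {m n} (fs gs : Vec (PR n) m) → Dec (fs ≡ gs)
  [] ≟PRs [] = yes refl
  (f ∷ fs) ≟PRs (g ∷ gs) with f ≟PR g | fs ≟PRs gs
  ... | yes refl | yes refl = yes refl
  ... | no ne | _ = no λ { refl → ne refl }
  ... | yes _ | no ne = no λ { refl → ne refl }

Triple : Set
Triple = Σ ℕ λ k → PR (suc k) × Vec ℕ k × ℕ

TrueTriple : Triple → Set
TrueTriple (k , P , m , n) = Holds P (m ∷ʳ n)

Functional : List Triple → Set
Functional l = ∀ {k} {P : PR (suc k)} {m : Vec ℕ k} {n n' : ℕ} →
  (k , P , m , n) ∈ l → (k , P , m , n') ∈ l → n ≡ n'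

-- A state: a finite set of true triples, functional in (P, m⃗).
-- Finite sets are represented by lists (up to the set equality _≈ˢ_).
record State : Set where
  constructor mkState
  field
    triples    : List Triple
    allTrue    : ∀ {x} → x ∈ triples → TrueTriple x
    functional : Functional triples
open State public

_∈ˢ_ : Triple → State → Set
x ∈ˢ s = x ∈ triples s

_∉ˢ_ : Triple → State → Set
x ∉ˢ s = ¬ (x ∈ˢ s)

_⊑_ : State → State → Set
s ⊑ s' = ∀ {x} → x ∈ˢ s → x ∈ˢ s'

_≈ˢ_ : State → State → Set
s ≈ˢ s' = (s ⊑ s') × (s' ⊑ s)

-- compatible: the union is again a state (truth of triples is automatic)
Compatible : State → State → Set
Compatible s s' = Functional (triples s ++ triples s')

𝒮 : Set → Set
𝒮 X = State → X

Increasing : (ℕ → State) → Set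
Increasing σ = ∀ i j → i ≤ j → σ i ⊑ σ j

EventuallyConstant : {X : Set} → (X → X → Set) → 𝒮 X → Set
EventuallyConstant _≈_ α = ∀ (σ : ℕ → State) → Increasing σ →
  ∃ λ N → ∀ i → N ≤ i → α (σ i) ≈ α (σ N)

-- Individual of 𝒮ℕ; being a function on *sets* of triples, it must not
-- distinguish set-equal list representations.
IndividualN : 𝒮 ℕ → Set
IndividualN α = (∀ {s s'} → s ≈ˢ s' → α s ≡ α s') × EventuallyConstant _≡_ α

IndividualS : 𝒮 State → Set
IndividualS α = (∀ {s s'} → s ≈ˢ s' → α s ≈ˢ α s') × EventuallyConstant _≈ˢ_ α

record InteractiveRealizer : Set where
  field
    run        : 𝒮 State
    individual : IndividualS run
    compatible : ∀ s → Compatible (run s) s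
    disjoint   : ∀ s {x} → x ∈ˢ run s → x ∉ˢ s
open InteractiveRealizer public

Prefix : InteractiveRealizer → State → Set
Prefix r s = run r s ⊑ s

data Term (n : ℕ) : Set where
  var   : Fin n → Term n
  `0    : Term n
  `succ : Term n → Term n
  fn    : ∀ {k} → PR k → Vec (Term n) k → Term n
  φ     : ∀ {k} → PR (suc k) → Vec (Term n) k → Term n

data Formula (n : ℕ) : Set where
  pred  : ∀ {k} → PR k → Vec (Term n) k → Formula n
  χ     : ∀ {k} → PR (suc k) → Vec (Term n) k → Formula n
  _≐_   : Term n → Term n → Formula n
  ¬ᶠ_   : Formula n → Formula n
  _∧ᶠ_  : Formula n → Formula n → Formula n
  _∨ᶠ_  : Formula n → Formula n → Formula n
  _⇒ᶠ_  : Formula n → Formula n → Formula n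

lookupT : List Triple → (k : ℕ) → PR (suc k) → Vec ℕ k → Maybe ℕ
lookupT List.[] k P m = nothing
lookupT ((k' , P' , m' , n) List.∷ l) k P m with k ℕ.≟ k'
... | no _ = lookupT l k P m
... | yes refl with P ≟PR P' | VP.≡-dec ℕ._≟_ m m'
... | yes _ | yes _ = just n
... | _ | _ = lookupT l k P m

Env : ℕ → Set
Env n = Fin n → 𝒮 ℕ

mutual
  ⟦_⟧ : ∀ {n} → Term n → Env n → 𝒮 ℕ
  ⟦ var x ⟧ ξ s = ξ x s
  ⟦ `0 ⟧ ξ s = 0
  ⟦ `succ t ⟧ ξ s = suc (⟦ t ⟧ ξ s)
  ⟦ fn f ts ⟧ ξ s = evalPR f (⟦ ts ⟧s ξ s)
  ⟦ φ {k} P ts ⟧ ξ s with lookupT (triples s) k P (⟦ ts ⟧s ξ s)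
  ... | just n = n
  ... | nothing = 0

  ⟦_⟧s : ∀ {n k} → Vec (Term n) k → Env n → 𝒮 (Vec ℕ k)
  ⟦ [] ⟧s ξ s = []
  ⟦ t ∷ ts ⟧s ξ s = ⟦ t ⟧ ξ s ∷ ⟦ ts ⟧s ξ s

isJust : {A : Set} → Maybe A → Bool
isJust (just _) = true
isJust nothing = false

⟦_⟧ᶠ : ∀ {n} → Formula n → Env n → 𝒮 Bool
⟦ pred P ts ⟧ᶠ ξ s = holds? P (⟦ ts ⟧s ξ s)
⟦ χ {k} P ts ⟧ᶠ ξ s = isJust (lookupT (triples s) k P (⟦ ts ⟧s ξ s))
⟦ t ≐ u ⟧ᶠ ξ s = ⌊ ⟦ t ⟧ ξ s ℕ.≟ ⟦ u ⟧ ξ s ⌋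
⟦ ¬ᶠ A ⟧ᶠ ξ s = not (⟦ A ⟧ᶠ ξ s)
⟦ A ∧ᶠ B ⟧ᶠ ξ s = ⟦ A ⟧ᶠ ξ s ∧ ⟦ B ⟧ᶠ ξ s
⟦ A ∨ᶠ B ⟧ᶠ ξ s = ⟦ A ⟧ᶠ ξ s ∨ ⟦ B ⟧ᶠ ξ s
⟦ A ⇒ᶠ B ⟧ᶠ ξ s = not (⟦ A ⟧ᶠ ξ s) ∨ ⟦ B ⟧ᶠ ξ s

mutual
  substT : ∀ {n m} → (Fin n → Term m) → Term n → Term m
  substT σ (var x) = σ x
  substT σ `0 = `0
  substT σ (`succ t) = `succ (substT σ t)
  substT σ (fn f ts) = fn f (substTs σ ts)
  substT σ (φ P ts) = φ P (substTs σ ts)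

  substTs : ∀ {n m k} → (Fin n → Term m) → Vec (Term n) k → Vec (Term m) k
  substTs σ [] = []
  substTs σ (t ∷ ts) = substT σ t ∷ substTs σ ts

substF : ∀ {n m} → (Fin n → Term m) → Formula n → Formula m
substF σ (pred P ts) = pred P (substTs σ ts)
substF σ (χ P ts) = χ P (substTs σ ts)
substF σ (t ≐ u) = substT σ t ≐ substT σ u
substF σ (¬ᶠ A) = ¬ᶠ substF σ A
substF σ (A ∧ᶠ B) = substF σ A ∧ᶠ substF σ B
substF σ (A ∨ᶠ B) = substF σ A ∨ᶠ substF σ B
substF σ (A ⇒ᶠ B) = substF σ A ⇒ᶠ substF σ B

-- Formulas A(x⃗, y) over k+1 variables: y is variable 0, x_i is variable (suc i).
-- A(x⃗, t) := substitute t (with free variables among x⃗) for y, leaving x⃗ fixed.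
_[_/y] : ∀ {k} → Formula (suc k) → Term k → Formula (suc k)
A [ t /y] = substF σ A
  where
  σ : Fin _ → Term _
  σ F.zero = substT (λ i → var (F.suc i)) t
  σ (F.suc i) = var (F.suc i)

_⊩_∶_ : ∀ {n} → InteractiveRealizer → Vector (𝒮 ℕ) n → Formula n → Set
r ⊩ γ ∶ A = ∀ s → Prefix r s → ⟦ A ⟧ᶠ (λ i _ → γ i s) s ≡ true

module Submission where

-- Realizability r ⊩ γ⃗ : A only inspects the truth value of A at a single
-- state s at a time, in the environment that freezes every γᵢ at its
-- value γᵢ(s).  Given a prefix state s of r, substitute-y turns the value
-- of A(x⃗, t) under (β, α⃗) into the value of A(x⃗, y) under (c, α⃗), where
-- c = ⟦t⟧(s) under α⃗.  The constant function λ_.c is an individual, so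
-- the hypothesis on A applied to α⃗ and λ_.c yields truth at s.  Neither
-- β nor t need be individuals: only values at the single state s are used.

open import Defs
open import Data.Nat using (ℕ; suc)
open import Data.Fin using (Fin; zero; suc)
open import Data.Vec.Functional using (Vector; _∷_)
open import Data.Vec using (Vec; []) renaming (_∷_ to _∷ᵛ_)
open import Data.Bool using (not; _∧_; _∨_)
open import Data.Product using (_,_)
open import Relation.Binary.PropositionalEquality using (_≡_; refl; cong; cong₂; trans)

module SubstitutionLemma {n m : ℕ} (σ : Fin n → Term m) (ξ : Env m) (ξ' : Env n)
         (s : State) (σ≈ξ' : ∀ i → ⟦ σ i ⟧ ξ s ≡ ξ' i s) where
  mutual
    subst-term : (t : Term n) → ⟦ substT σ t ⟧ ξ s ≡ ⟦ t ⟧ ξ' s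
    subst-term (var x)   = σ≈ξ' x
    subst-term `0        = refl
    subst-term (`succ t) = cong suc (subst-term t)
    subst-term (fn f ts) = cong (evalPR f) (subst-terms ts)
    subst-term (φ P ts) rewrite subst-terms ts = refl

    subst-terms : ∀ {j} (ts : Vec (Term n) j) → ⟦ substTs σ ts ⟧s ξ s ≡ ⟦ ts ⟧s ξ' s
    subst-terms []         = refl
    subst-terms (t ∷ᵛ ts) = cong₂ _∷ᵛ_ (subst-term t) (subst-terms ts)

  subst-formula : (A : Formula n) → ⟦ substF σ A ⟧ᶠ ξ s ≡ ⟦ A ⟧ᶠ ξ' s
  subst-formula (pred P ts) = cong (holds? P) (subst-terms ts)
  subst-formula (χ P ts) rewrite subst-terms ts = refl
  subst-formula (t ≐ u) rewrite subst-term t | subst-term u = refl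
  subst-formula (¬ᶠ A)   = cong not (subst-formula A)
  subst-formula (A ∧ᶠ B) = cong₂ _∧_ (subst-formula A) (subst-formula B)
  subst-formula (A ∨ᶠ B) = cong₂ _∨_ (subst-formula A) (subst-formula B)
  subst-formula (A ⇒ᶠ B) = cong₂ (λ a b → not a ∨ b) (subst-formula A) (subst-formula B)

open SubstitutionLemma using (subst-term; subst-formula)

frozenAt : ∀ {n} → Vector (𝒮 ℕ) n → State → Env n
frozenAt γ s i _ = γ i s

-- The substitution is the one built into _[_/y], found by unification; on y
-- it shifts the x⃗-variables of t past y, which does not change its value.
substitute-y : ∀ {k} (A : Formula (suc k)) (t : Term k) (β : 𝒮 ℕ) (α : Vector (𝒮 ℕ) k)
  (s : State) →
  ⟦ A [ t /y] ⟧ᶠ (frozenAt (β ∷ α) s) s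
    ≡ ⟦ A ⟧ᶠ (frozenAt ((λ _ → ⟦ t ⟧ (frozenAt α s) s) ∷ α) s) s
substitute-y A t β α s = subst-formula _ (frozenAt (β ∷ α) s) _ s
  (λ { zero    → subst-term (λ i → var (suc i)) (frozenAt (β ∷ α) s) (frozenAt α s) s
                   (λ _ → refl) t
     ; (suc i) → refl })
  A

constant-individual : (c : ℕ) → IndividualN (λ _ → c)
constant-individual c = (λ _ → refl) , λ _ _ → 0 , λ _ _ → refl

lemma6p14 : ∀ {k : ℕ} (A : Formula (suc k)) (r : InteractiveRealizer) →
    (∀ (α : Vector (𝒮 ℕ) k) (β : 𝒮 ℕ) → (∀ i → IndividualN (α i)) → IndividualN β →
      r ⊩ (β ∷ α) ∶ A) →
    ∀ (t : Term k) (α : Vector (𝒮 ℕ) k) (β : 𝒮 ℕ) → (∀ i → IndividualN (α i)) → IndividualN β →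
      r ⊩ (β ∷ α) ∶ (A [ t /y])
lemma6p14 A r realizes-A t α β α-ind _ s prefix =
  trans (substitute-y A t β α s)
        (realizes-A α (λ _ → c) α-ind (constant-individual c) s prefix)
  where
  c : ℕ
  c = ⟦ t ⟧ (frozenAt α s) s
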